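{- Let $\mathcal{C}$ be a symmetric monoidal closed category with unit ${\mathbf 1}$, and let $(N, 0 : {\mathbf 1} \to N, succ : N \to N)$ be a natural number object in $\mathcal{C}$. Then $N$ is a monoidal object of numerals, i.e. there exists a morphism $pred : N \to N$ such that $pred \circ (n+1) = n$ for every numeral $n : {\mathbf 1} \to N$.
   Context: A natural number object in a symmetric monoidal closed category $\mathcal{C}$ is an object $N$ with morphisms $0 : {\mathbf 1} \to N$ and $succ : N \to N$ such that for every object $A$ and every pair of morphisms $c : {\mathbf 1} \to A$, $f : A \to A$ there is a unique $h : N \to A$ with $h \circ 0 = c$ and $h \circ succ = f \circ h$. Numerals $n : {\mathbf 1} \to N$ are defined inductively: the numeral $0$ is the morphism $0$, and the numeral $n+1$ is $succ \circ n$. An object $N$ with $0$ and $succ$ is a monoidal object of numerals if it is additionally equipped with a morphism $pred : N \to N$ such that $pred \circ (n+1) = n$ for every numeral $n$. -}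

module Defs where

open import Level using (Level; _⊔_; suc)
open import Data.Nat using (ℕ; zero) renaming (suc to 1+)
open import Data.Product using (Σ; _×_)
open import Relation.Binary using (IsEquivalence)

record Category (o ℓ e : Level) : Set (Level.suc (o ⊔ ℓ ⊔ e)) where
  infixr 9 _∘_
  infix  4 _≈_
  field
    Obj : Set o
    Hom : Obj → Obj → Set ℓ
    _≈_ : ∀ {A B} → Hom A B → Hom A B → Set e
    id  : ∀ {A} → Hom A A
    _∘_ : ∀ {A B C} → Hom B C → Hom A B → Hom A C
    ≈-equiv   : ∀ {A B} → IsEquivalence (_≈_ {A} {B})
    ∘-resp-≈  : ∀ {A B C} {f f′ : Hom B C} {g g′ : Hom A B} →
                f ≈ f′ → g ≈ g′ → f ∘ g ≈ f′ ∘ g′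
    assoc     : ∀ {A B C D} {f : Hom A B} {g : Hom B C} {h : Hom C D} →
                (h ∘ g) ∘ f ≈ h ∘ (g ∘ f)
    identityˡ : ∀ {A B} {f : Hom A B} → id ∘ f ≈ f
    identityʳ : ∀ {A B} {f : Hom A B} → f ∘ id ≈ f

record SymmetricMonoidalClosedCategory (o ℓ e : Level) : Set (Level.suc (o ⊔ ℓ ⊔ e)) where
  field
    category : Category o ℓ e
  open Category category public
  infixr 10 _⊗₀_ _⊗₁_
  field
    _⊗₀_ : Obj → Obj → Obj
    _⊗₁_ : ∀ {A B C D} → Hom A B → Hom C D → Hom (A ⊗₀ C) (B ⊗₀ D)
    ⊗-identity : ∀ {A B} → id {A} ⊗₁ id {B} ≈ id
    ⊗-homomorphism : ∀ {A B C D E F} {f : Hom A B} {g : Hom B C} {h : Hom D E} {k : Hom E F} →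
                     (g ∘ f) ⊗₁ (k ∘ h) ≈ (g ⊗₁ k) ∘ (f ⊗₁ h)
    ⊗-resp-≈ : ∀ {A B C D} {f f′ : Hom A B} {g g′ : Hom C D} →
               f ≈ f′ → g ≈ g′ → f ⊗₁ g ≈ f′ ⊗₁ g′
    unit : Obj
    α⇒ : ∀ {A B C} → Hom ((A ⊗₀ B) ⊗₀ C) (A ⊗₀ (B ⊗₀ C))
    α⇐ : ∀ {A B C} → Hom (A ⊗₀ (B ⊗₀ C)) ((A ⊗₀ B) ⊗₀ C)
    α-isoˡ : ∀ {A B C} → α⇐ {A} {B} {C} ∘ α⇒ ≈ id
    α-isoʳ : ∀ {A B C} → α⇒ {A} {B} {C} ∘ α⇐ ≈ id
    α-natural : ∀ {A B C D E F} {f : Hom A D} {g : Hom B E} {h : Hom C F} →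
                α⇒ ∘ ((f ⊗₁ g) ⊗₁ h) ≈ (f ⊗₁ (g ⊗₁ h)) ∘ α⇒
    λ⇒ : ∀ {A} → Hom (unit ⊗₀ A) A
    λ⇐ : ∀ {A} → Hom A (unit ⊗₀ A)
    λ-isoˡ : ∀ {A} → λ⇐ {A} ∘ λ⇒ ≈ id
    λ-isoʳ : ∀ {A} → λ⇒ {A} ∘ λ⇐ ≈ id
    λ-natural : ∀ {A B} {f : Hom A B} → λ⇒ ∘ (id ⊗₁ f) ≈ f ∘ λ⇒
    ρ⇒ : ∀ {A} → Hom (A ⊗₀ unit) A
    ρ⇐ : ∀ {A} → Hom A (A ⊗₀ unit)
    ρ-isoˡ : ∀ {A} → ρ⇐ {A} ∘ ρ⇒ ≈ id
    ρ-isoʳ : ∀ {A} → ρ⇒ {A} ∘ ρ⇐ ≈ id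
    ρ-natural : ∀ {A B} {f : Hom A B} → ρ⇒ ∘ (f ⊗₁ id) ≈ f ∘ ρ⇒
    pentagon : ∀ {A B C D} →
               (id {A} ⊗₁ α⇒ {B} {C} {D}) ∘ α⇒ ∘ (α⇒ ⊗₁ id) ≈ α⇒ ∘ α⇒
    triangle : ∀ {A B} → (id {A} ⊗₁ λ⇒ {B}) ∘ α⇒ ≈ ρ⇒ ⊗₁ id
    σ : ∀ {A B} → Hom (A ⊗₀ B) (B ⊗₀ A)
    σ-natural : ∀ {A B C D} {f : Hom A B} {g : Hom C D} →
                σ ∘ (f ⊗₁ g) ≈ (g ⊗₁ f) ∘ σ
    σ-involutive : ∀ {A B} → σ {B} {A} ∘ σ {A} {B} ≈ id
    hexagon : ∀ {A B C} →
              (id {B} ⊗₁ σ {A} {C}) ∘ α⇒ ∘ (σ ⊗₁ id) ≈ α⇒ ∘ σ ∘ α⇒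
    [_,_] : Obj → Obj → Obj
    eval  : ∀ {B C} → Hom ([ B , C ] ⊗₀ B) C
    curry : ∀ {A B C} → Hom (A ⊗₀ B) C → Hom A [ B , C ]
    curry-β : ∀ {A B C} {f : Hom (A ⊗₀ B) C} → eval ∘ (curry f ⊗₁ id) ≈ f
    curry-unique : ∀ {A B C} {f : Hom (A ⊗₀ B) C} {g : Hom A [ B , C ]} →
                   eval ∘ (g ⊗₁ id) ≈ f → g ≈ curry f

module _ {o ℓ e} (𝒞 : SymmetricMonoidalClosedCategory o ℓ e) where
  open SymmetricMonoidalClosedCategory 𝒞

  record IsNNO (N : Obj) (z : Hom unit N) (s : Hom N N) : Set (o ⊔ ℓ ⊔ e) where
    field
      rec        : ∀ {A} → Hom unit A → Hom A A → Hom N A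
      rec-zero   : ∀ {A} {c : Hom unit A} {f : Hom A A} → rec c f ∘ z ≈ c
      rec-succ   : ∀ {A} {c : Hom unit A} {f : Hom A A} → rec c f ∘ s ≈ f ∘ rec c f
      rec-unique : ∀ {A} {c : Hom unit A} {f : Hom A A} {h : Hom N A} →
                   h ∘ z ≈ c → h ∘ s ≈ f ∘ h → h ≈ rec c f

  numeral : {N : Obj} → Hom unit N → Hom N N → ℕ → Hom unit N
  numeral z s zero   = z
  numeral z s (1+ n) = s ∘ numeral z s n

  IsObjectOfNumerals : (N : Obj) → Hom unit N → Hom N N → Set (ℓ ⊔ e)
  IsObjectOfNumerals N z s =
    Σ (Hom N N) λ pred → ∀ (n : ℕ) → pred ∘ numeral z s (1+ n) ≈ numeral z s n

module Submission where

-- Write ⟨ a , b ⟩ = (a ⊗₁ b) ∘ λ⇐ : 𝟏 → A ⊗ B for the pair of two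
-- global elements.  As for the natural numbers in a cartesian setting, the
-- predecessor is obtained by iterating the step (x , y) ↦ (y , y + 1) from
-- (0 , 0) and returning the first component.  In a monoidal category there are
-- no projections or diagonals, but on numerals they can be simulated:
--   * discard = rec id id : N → 𝟏 sends every numeral to id, which lets us read
--     the right component of a pair through the left unitor;
--   * copy = rec ⟨ 0 , 0 ⟩ (s ⊗₁ s) duplicates numerals;
--   * the left component is read through the closed structure: constant sends
--     a numeral n to the name of the constant map at n, and evaluating it
--     against the right component returns n.
-- Everything about these maps on numerals follows from one general fact,
-- rec-numeral: rec c f agrees on numerals with any sequence that starts at c
-- and is advanced by f.

open import Defs
open import Data.Nat using (ℕ; zero; pred) renaming (suc to 1+)
open import Data.Product using (_,_)
open import Relation.Binary using (Setoid; IsEquivalence)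
import Relation.Binary.Reasoning.Setoid as SetoidReasoning

module ElementCalculus {o ℓ e} (𝒞 : SymmetricMonoidalClosedCategory o ℓ e) where
  open SymmetricMonoidalClosedCategory 𝒞

  module _ {A B : Obj} where
    open IsEquivalence (≈-equiv {A} {B}) public
      renaming (refl to ≈-refl; sym to ≈-sym; trans to ≈-trans)

  hom-setoid : Obj → Obj → Setoid ℓ e
  hom-setoid A B = record { Carrier = Hom A B ; _≈_ = _≈_ ; isEquivalence = ≈-equiv }

  ∘-resp-≈ˡ : ∀ {A B C} {f f′ : Hom B C} {g : Hom A B} → f ≈ f′ → f ∘ g ≈ f′ ∘ g
  ∘-resp-≈ˡ p = ∘-resp-≈ p ≈-refl

  ∘-resp-≈ʳ : ∀ {A B C} {f : Hom B C} {g g′ : Hom A B} → g ≈ g′ → f ∘ g ≈ f ∘ g′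
  ∘-resp-≈ʳ p = ∘-resp-≈ ≈-refl p

  ⟨_,_⟩ : ∀ {A B} → Hom unit A → Hom unit B → Hom unit (A ⊗₀ B)
  ⟨ a , b ⟩ = (a ⊗₁ b) ∘ λ⇐

  ⟨⟩-resp-≈ : ∀ {A B} {a a′ : Hom unit A} {b b′ : Hom unit B} →
              a ≈ a′ → b ≈ b′ → ⟨ a , b ⟩ ≈ ⟨ a′ , b′ ⟩
  ⟨⟩-resp-≈ p q = ∘-resp-≈ˡ (⊗-resp-≈ p q)

  ⊗-pair : ∀ {A B C D} {f : Hom A C} {g : Hom B D} {a : Hom unit A} {b : Hom unit B} →
           (f ⊗₁ g) ∘ ⟨ a , b ⟩ ≈ ⟨ f ∘ a , g ∘ b ⟩
  ⊗-pair = ≈-trans (≈-sym assoc) (∘-resp-≈ˡ (≈-sym ⊗-homomorphism))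

  λ⇒-pair : ∀ {B} {b : Hom unit B} → λ⇒ ∘ ⟨ id , b ⟩ ≈ b
  λ⇒-pair {b = b} = begin
      λ⇒ ∘ ((id ⊗₁ b) ∘ λ⇐) ≈⟨ ≈-sym assoc ⟩
      (λ⇒ ∘ (id ⊗₁ b)) ∘ λ⇐ ≈⟨ ∘-resp-≈ˡ λ-natural ⟩
      (b ∘ λ⇒) ∘ λ⇐         ≈⟨ assoc ⟩
      b ∘ (λ⇒ ∘ λ⇐)         ≈⟨ ∘-resp-≈ʳ λ-isoʳ ⟩
      b ∘ id                ≈⟨ identityʳ ⟩
      b                     ∎
    where open SetoidReasoning (hom-setoid _ _)

  curry-resp-≈ : ∀ {A B C} {f f′ : Hom (A ⊗₀ B) C} → f ≈ f′ → curry f ≈ curry f′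
  curry-resp-≈ p = curry-unique (≈-trans curry-β p)

  curry-postcompose : ∀ {A B C D} {g : Hom C D} {f : Hom (A ⊗₀ B) C} →
                      curry (g ∘ eval) ∘ curry f ≈ curry (g ∘ f)
  curry-postcompose {g = g} {f} = curry-unique (begin
      eval ∘ ((curry (g ∘ eval) ∘ curry f) ⊗₁ id)
        ≈⟨ ∘-resp-≈ʳ (≈-trans (⊗-resp-≈ ≈-refl (≈-sym identityˡ)) ⊗-homomorphism) ⟩
      eval ∘ ((curry (g ∘ eval) ⊗₁ id) ∘ (curry f ⊗₁ id))
        ≈⟨ ≈-sym assoc ⟩
      (eval ∘ (curry (g ∘ eval) ⊗₁ id)) ∘ (curry f ⊗₁ id)
        ≈⟨ ∘-resp-≈ˡ curry-β ⟩
      (g ∘ eval) ∘ (curry f ⊗₁ id)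
        ≈⟨ assoc ⟩
      g ∘ (eval ∘ (curry f ⊗₁ id))
        ≈⟨ ∘-resp-≈ʳ curry-β ⟩
      g ∘ f ∎)
    where open SetoidReasoning (hom-setoid _ _)

  eval-pair : ∀ {A B} {f : Hom (unit ⊗₀ A) B} {b : Hom unit A} →
              eval ∘ ⟨ curry f , b ⟩ ≈ f ∘ ⟨ id , b ⟩
  eval-pair {f = f} {b} = begin
      eval ∘ ⟨ curry f , b ⟩                ≈⟨ ∘-resp-≈ʳ (⟨⟩-resp-≈ (≈-sym identityʳ) (≈-sym identityˡ)) ⟩
      eval ∘ ⟨ curry f ∘ id , id ∘ b ⟩      ≈⟨ ∘-resp-≈ʳ (≈-sym ⊗-pair) ⟩
      eval ∘ ((curry f ⊗₁ id) ∘ ⟨ id , b ⟩) ≈⟨ ≈-sym assoc ⟩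
      (eval ∘ (curry f ⊗₁ id)) ∘ ⟨ id , b ⟩ ≈⟨ ∘-resp-≈ˡ curry-β ⟩
      f ∘ ⟨ id , b ⟩                        ∎
    where open SetoidReasoning (hom-setoid _ _)

module Predecessor {o ℓ e} (𝒞 : SymmetricMonoidalClosedCategory o ℓ e)
  (N : SymmetricMonoidalClosedCategory.Obj 𝒞)
  (z : SymmetricMonoidalClosedCategory.Hom 𝒞 (SymmetricMonoidalClosedCategory.unit 𝒞) N)
  (s : SymmetricMonoidalClosedCategory.Hom 𝒞 N N)
  (nno : IsNNO 𝒞 N z s) where
  open SymmetricMonoidalClosedCategory 𝒞
  open ElementCalculus 𝒞
  open IsNNO nno

  num : ℕ → Hom unit N
  num = numeral 𝒞 z s

  rec-numeral : ∀ {A} {c : Hom unit A} {f : Hom A A} (x : ℕ → Hom unit A) →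
                c ≈ x zero → (∀ n → f ∘ x n ≈ x (1+ n)) →
                ∀ n → rec c f ∘ num n ≈ x n
  rec-numeral x initial step zero   = ≈-trans rec-zero initial
  rec-numeral {c = c} {f} x initial step (1+ n) = begin
      rec c f ∘ (s ∘ num n)   ≈⟨ ≈-sym assoc ⟩
      (rec c f ∘ s) ∘ num n   ≈⟨ ∘-resp-≈ˡ rec-succ ⟩
      (f ∘ rec c f) ∘ num n   ≈⟨ assoc ⟩
      f ∘ (rec c f ∘ num n)   ≈⟨ ∘-resp-≈ʳ (rec-numeral x initial step n) ⟩
      f ∘ x n                 ≈⟨ step n ⟩
      x (1+ n)                ∎
    where open SetoidReasoning (hom-setoid _ _)

  discard : Hom N unit
  discard = rec id id

  discard-numeral : ∀ n → discard ∘ num n ≈ id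
  discard-numeral = rec-numeral (λ _ → id) ≈-refl (λ _ → identityˡ)

  copy : Hom N (N ⊗₀ N)
  copy = rec ⟨ z , z ⟩ (s ⊗₁ s)

  copy-numeral : ∀ n → copy ∘ num n ≈ ⟨ num n , num n ⟩
  copy-numeral = rec-numeral (λ n → ⟨ num n , num n ⟩) ≈-refl (λ _ → ⊗-pair)

  second : Hom (N ⊗₀ N) N
  second = λ⇒ ∘ (discard ⊗₁ id)

  second-pair : ∀ m (b : Hom unit N) → second ∘ ⟨ num m , b ⟩ ≈ b
  second-pair m b = begin
      (λ⇒ ∘ (discard ⊗₁ id)) ∘ ⟨ num m , b ⟩  ≈⟨ assoc ⟩
      λ⇒ ∘ ((discard ⊗₁ id) ∘ ⟨ num m , b ⟩)  ≈⟨ ∘-resp-≈ʳ ⊗-pair ⟩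
      λ⇒ ∘ ⟨ discard ∘ num m , id ∘ b ⟩       ≈⟨ ∘-resp-≈ʳ (⟨⟩-resp-≈ (discard-numeral m) identityˡ) ⟩
      λ⇒ ∘ ⟨ id , b ⟩                          ≈⟨ λ⇒-pair ⟩
      b                                        ∎
    where open SetoidReasoning (hom-setoid _ _)

  shift : Hom (N ⊗₀ N) (N ⊗₀ N)
  shift = (id ⊗₁ s) ∘ copy ∘ second

  shift-pair : ∀ m n → shift ∘ ⟨ num m , num n ⟩ ≈ ⟨ num n , num (1+ n) ⟩
  shift-pair m n = begin
      ((id ⊗₁ s) ∘ copy ∘ second) ∘ ⟨ num m , num n ⟩  ≈⟨ assoc ⟩
      (id ⊗₁ s) ∘ (copy ∘ second) ∘ ⟨ num m , num n ⟩  ≈⟨ ∘-resp-≈ʳ assoc ⟩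
      (id ⊗₁ s) ∘ copy ∘ second ∘ ⟨ num m , num n ⟩    ≈⟨ ∘-resp-≈ʳ (∘-resp-≈ʳ (second-pair m (num n))) ⟩
      (id ⊗₁ s) ∘ copy ∘ num n                         ≈⟨ ∘-resp-≈ʳ (copy-numeral n) ⟩
      (id ⊗₁ s) ∘ ⟨ num n , num n ⟩                    ≈⟨ ⊗-pair ⟩
      ⟨ id ∘ num n , num (1+ n) ⟩                      ≈⟨ ⟨⟩-resp-≈ identityˡ ≈-refl ⟩
      ⟨ num n , num (1+ n) ⟩                           ∎
    where open SetoidReasoning (hom-setoid _ _)

  withPredecessor : Hom N (N ⊗₀ N)
  withPredecessor = rec ⟨ z , z ⟩ shift

  withPredecessor-numeral : ∀ n → withPredecessor ∘ num n ≈ ⟨ num (pred n) , num n ⟩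
  withPredecessor-numeral =
    rec-numeral (λ n → ⟨ num (pred n) , num n ⟩) ≈-refl (λ n → shift-pair (pred n) n)

  erase : Hom (unit ⊗₀ N) unit
  erase = λ⇒ ∘ (id ⊗₁ discard)

  erase-pair : ∀ n → erase ∘ ⟨ id , num n ⟩ ≈ id
  erase-pair n = begin
      (λ⇒ ∘ (id ⊗₁ discard)) ∘ ⟨ id , num n ⟩  ≈⟨ assoc ⟩
      λ⇒ ∘ (id ⊗₁ discard) ∘ ⟨ id , num n ⟩    ≈⟨ ∘-resp-≈ʳ ⊗-pair ⟩
      λ⇒ ∘ ⟨ id ∘ id , discard ∘ num n ⟩       ≈⟨ ∘-resp-≈ʳ (⟨⟩-resp-≈ identityˡ (discard-numeral n)) ⟩
      λ⇒ ∘ ⟨ id , id ⟩                         ≈⟨ λ⇒-pair ⟩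
      id                                       ∎
    where open SetoidReasoning (hom-setoid _ _)

  constant : Hom N [ N , N ]
  constant = rec (curry (z ∘ erase)) (curry (s ∘ eval))

  constant-numeral : ∀ n → constant ∘ num n ≈ curry (num n ∘ erase)
  constant-numeral = rec-numeral (λ n → curry (num n ∘ erase)) ≈-refl
    (λ n → ≈-trans curry-postcompose (curry-resp-≈ (≈-sym assoc)))

  first : Hom (N ⊗₀ N) N
  first = eval ∘ (constant ⊗₁ id)

  first-pair : ∀ m n → first ∘ ⟨ num m , num n ⟩ ≈ num m
  first-pair m n = begin
      (eval ∘ (constant ⊗₁ id)) ∘ ⟨ num m , num n ⟩  ≈⟨ assoc ⟩
      eval ∘ (constant ⊗₁ id) ∘ ⟨ num m , num n ⟩    ≈⟨ ∘-resp-≈ʳ ⊗-pair ⟩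
      eval ∘ ⟨ constant ∘ num m , id ∘ num n ⟩       ≈⟨ ∘-resp-≈ʳ (⟨⟩-resp-≈ (constant-numeral m) identityˡ) ⟩
      eval ∘ ⟨ curry (num m ∘ erase) , num n ⟩       ≈⟨ eval-pair ⟩
      (num m ∘ erase) ∘ ⟨ id , num n ⟩               ≈⟨ assoc ⟩
      num m ∘ erase ∘ ⟨ id , num n ⟩                 ≈⟨ ∘-resp-≈ʳ (erase-pair n) ⟩
      num m ∘ id                                     ≈⟨ identityʳ ⟩
      num m                                          ∎
    where open SetoidReasoning (hom-setoid _ _)

  predecessor : Hom N N
  predecessor = first ∘ withPredecessor

  predecessor-numeral : ∀ n → predecessor ∘ num (1+ n) ≈ num n
  predecessor-numeral n = begin
      (first ∘ withPredecessor) ∘ num (1+ n)  ≈⟨ assoc ⟩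
      first ∘ withPredecessor ∘ num (1+ n)    ≈⟨ ∘-resp-≈ʳ (withPredecessor-numeral (1+ n)) ⟩
      first ∘ ⟨ num n , num (1+ n) ⟩          ≈⟨ first-pair n (1+ n) ⟩
      num n                                   ∎
    where open SetoidReasoning (hom-setoid _ _)

proposition1 : ∀ {o ℓ e} (𝒞 : SymmetricMonoidalClosedCategory o ℓ e) →
    let open SymmetricMonoidalClosedCategory 𝒞 in
    (N : Obj) (z : Hom unit N) (s : Hom N N) →
    IsNNO 𝒞 N z s → IsObjectOfNumerals 𝒞 N z s
proposition1 𝒞 N z s nno = predecessor , predecessor-numeral
  where open Predecessor 𝒞 N z s nno
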